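{- Let $G$ be a connected graph and $u,v\in V(G)$ with $u$ not adjacent to $v$ and $d(u)\ge d(v)$. Let $v_1,\dots,v_s\in N(v)\setminus N(u)$ with $1\le s\le d(v)$, and let $G'=G-\{vv_1,\dots,vv_s\}+\{uv_1,\dots,uv_s\}$. Then $\prod_2(G')>\prod_2(G)$.
   Context: $N(w)$ is the neighborhood and $d(w)=|N(w)|$ the degree of a vertex $w$. $\prod_2(G)=\prod_{xy\in E(G)} d(x)d(y)$. -}

module Defs where

open import Data.Nat using (ℕ; _+_; _*_)
open import Data.Bool using (Bool; true; false; _∧_; _∨_; not; if_then_else_)
open import Data.Fin using (Fin; toℕ; _≟_)
open import Data.Nat using (_<ᵇ_)
open import Data.List using (List; map; allFin)
open import Data.Nat.ListAction using (sum; product)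
open import Relation.Nullary.Decidable using (⌊_⌋)
open import Relation.Binary.PropositionalEquality using (_≡_)

Adj : ℕ → Set
Adj n = Fin n → Fin n → Bool

record SimpleGraph (n : ℕ) : Set where
  field
    adj    : Adj n
    sym    : ∀ x y → adj x y ≡ adj y x
    irrefl : ∀ x → adj x x ≡ false
open SimpleGraph public

deg : ∀ {n} → Adj n → Fin n → ℕ
deg {n} A w = sum (map (λ j → if A w j then 1 else 0) (allFin n))

-- Π₂(G) = ∏_{xy ∈ E(G)} d(x) d(y); each edge {x,y} counted once (x < y).
prod2 : ∀ {n} → Adj n → ℕ
prod2 {n} A =
  product (map (λ x →
    product (map (λ y →
      if A x y ∧ (toℕ x <ᵇ toℕ y) then deg A x * deg A y else 1)
      (allFin n)))
    (allFin n))

data Reach {n : ℕ} (A : Adj n) : Fin n → Fin n → Set where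
  here : ∀ {x} → Reach A x x
  step : ∀ {x y z} → A x y ≡ true → Reach A y z → Reach A x z

Connected : ∀ {n} → SimpleGraph n → Set
Connected {n} G = ∀ (x y : Fin n) → Reach (adj G) x y

_==_ : ∀ {n} → Fin n → Fin n → Bool
x == y = ⌊ x ≟ y ⌋

-- Is {x,y} = {c,w} for some w in S ?
touches : ∀ {n} → (S : Fin n → Bool) → Fin n → Fin n → Fin n → Bool
touches S c x y = (x == c ∧ S y) ∨ (y == c ∧ S x)

-- G' = G - {v w : w ∈ S} + {u w : w ∈ S}
move : ∀ {n} → SimpleGraph n → (u v : Fin n) → (S : Fin n → Bool) → Adj n
move G u v S x y = (adj G x y ∧ not (touches S v x y)) ∨ touches S u x y

module Submission where

-- Every vertex x occurs in Π₂(G) = ∏_{xy ∈ E} d(x)d(y) once per incident edge,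
-- so Π₂(G) = ∏_x d(x)^d(x).  The move raises d(u) by s = |S|, lowers d(v) by s
-- and leaves every other degree unchanged, so only the factors at u and v of
-- this product change.  The function x ↦ x^x is strictly log-convex
-- (f(k+1)² < f(k+2)f(k)), and for such f moving t ≥ 1 units from a smaller
-- argument to a larger one strictly increases f(a)f(b).

open import Defs
open import Data.Nat using (ℕ; _≤_; _<_)
open import Data.Bool using (Bool; true; false)
open import Data.Fin using (Fin)
open import Data.Product using (∃-syntax)
open import Relation.Binary.PropositionalEquality using (_≡_; _≢_)

open import Data.Nat using (zero; suc; _+_; _*_; _^_; _<ᵇ_; z<s; s≤s⁻¹; >-nonZero)
open import Data.Nat.Properties
  using (+-identityʳ; +-comm; +-assoc; +-cancelʳ-≡; +-cancelʳ-≤; +-monoʳ-≤; +-monoˡ-≤; +-monoʳ-<;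
         *-comm; *-assoc; *-mono-<; *-monoʳ-<; *-monoˡ-<; *-monoʳ-≤; *-cancelˡ-<; *-cancelʳ-<;
         <-≤-trans; ≤-reflexive; n≤1+n; m≤m+n; m≤n+m; m<m+n; m<n+m; m≤n⇒m<n∨m≡n;
         ^-monoˡ-≤; ^-distribˡ-+-*; m^n>0; m^n≢0; module ≤-Reasoning;
         +-0-commutativeMonoid; *-1-commutativeMonoid)
open import Data.Nat.Tactic.RingSolver using (solve-∀)
open import Data.Bool using (_∧_; _∨_; not; if_then_else_)
open import Data.Bool.Properties using (∨-comm; ∨-idem; ∧-identityʳ; ∧-zeroʳ; ∨-identityʳ; ¬-not)
open import Data.Fin using (zero; suc; toℕ; _≟_)
open import Data.Fin.Properties using (toℕ-injective; suc-injective)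
open import Data.Vec.Functional using (updateAt)
open import Data.Vec.Functional.Properties using (updateAt-updates; updateAt-minimal)
open import Data.List using (map; allFin; tabulate)
open import Data.List.Properties using (map-tabulate)
open import Data.Nat.ListAction using (sum; product)
open import Data.Product using (_×_; _,_)
open import Data.Sum using (_⊎_; inj₁; inj₂)
open import Function using (_∘_; id; const)
open import Relation.Nullary using (yes; no; contradiction)
open import Relation.Nullary.Decidable using (⌊⌋-map′)
open import Relation.Binary.PropositionalEquality
  using (refl; trans; cong; cong₂; subst; subst₂; module ≡-Reasoning)
  renaming (sym to ≡-sym)
import Algebra.Properties.CommutativeMonoid.Sum as BigOp

open BigOp +-0-commutativeMonoid using ()
  renaming (sum to ∑; ∑-distrib-+ to ∑-distrib; sum-cong-≗ to ∑-cong; sum-replicate-zero to ∑-zero)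
open BigOp *-1-commutativeMonoid using ()
  renaming (sum to ∏; ∑-distrib-+ to ∏-distrib; ∑-comm to ∏-comm; sum-cong-≗ to ∏-cong)

ι : Bool → ℕ
ι b = if b then 1 else 0

sum-tabulate : ∀ {n} (f : Fin n → ℕ) → sum (tabulate f) ≡ ∑ f
sum-tabulate {zero}  f = refl
sum-tabulate {suc n} f = cong (f zero +_) (sum-tabulate (f ∘ suc))

product-tabulate : ∀ {n} (f : Fin n → ℕ) → product (tabulate f) ≡ ∏ f
product-tabulate {zero}  f = refl
product-tabulate {suc n} f = cong (f zero *_) (product-tabulate (f ∘ suc))

sum-allFin : ∀ {n} (f : Fin n → ℕ) → sum (map f (allFin n)) ≡ ∑ f
sum-allFin f = trans (cong sum (map-tabulate id f)) (sum-tabulate f)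

product-allFin : ∀ {n} (f : Fin n → ℕ) → product (map f (allFin n)) ≡ ∏ f
product-allFin f = trans (cong product (map-tabulate id f)) (product-tabulate f)

deg-∑ : ∀ {n} (A : Adj n) x → deg A x ≡ ∑ (λ y → ι (A x y))
deg-∑ A x = sum-allFin (λ y → ι (A x y))

∏-pos : ∀ {n} (f : Fin n → ℕ) → (∀ x → 0 < f x) → 0 < ∏ f
∏-pos {zero}  f pos = z<s
∏-pos {suc n} f pos = *-mono-< (pos zero) (∏-pos (f ∘ suc) (pos ∘ suc))

∑-pos : ∀ {n} (f : Fin n → ℕ) w → 0 < f w → 0 < ∑ f
∑-pos f zero    fw>0 = <-≤-trans fw>0 (m≤m+n _ _)
∑-pos f (suc w) fw>0 = <-≤-trans (∑-pos (f ∘ suc) w fw>0) (m≤n+m _ _)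

∏-power : ∀ {n} (b : Fin n → Bool) c → ∏ (λ y → if b y then c else 1) ≡ c ^ ∑ (λ y → ι (b y))
∏-power {zero}  b c = refl
∏-power {suc n} b c with b zero
... | true  = cong (c *_) (∏-power (b ∘ suc) c)
... | false = trans (+-identityʳ _) (∏-power (b ∘ suc) c)

∏-update : ∀ {n} (f g : Fin n → ℕ) u → (∀ x → x ≢ u → f x ≡ g x) →
           ∏ f * g u ≡ ∏ g * f u
∏-update {suc n} f g zero agree = begin
    f zero * ∏ (f ∘ suc) * g zero ≡⟨ cong (λ p → f zero * p * g zero) rest ⟩
    f zero * ∏ (g ∘ suc) * g zero ≡⟨ swap (f zero) (∏ (g ∘ suc)) (g zero) ⟩
    g zero * ∏ (g ∘ suc) * f zero ∎
  where
  open ≡-Reasoning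
  rest : ∏ (f ∘ suc) ≡ ∏ (g ∘ suc)
  rest = ∏-cong (λ x → agree (suc x) λ ())
  swap : ∀ a p b → a * p * b ≡ b * p * a
  swap = solve-∀
∏-update {suc n} f g (suc u) agree = begin
    f zero * ∏ (f ∘ suc) * g (suc u)   ≡⟨ *-assoc (f zero) _ _ ⟩
    f zero * (∏ (f ∘ suc) * g (suc u)) ≡⟨ cong₂ _*_ (agree zero λ ()) rest ⟩
    g zero * (∏ (g ∘ suc) * f (suc u)) ≡⟨ *-assoc (g zero) _ _ ⟨
    g zero * ∏ (g ∘ suc) * f (suc u)   ∎
  where
  open ≡-Reasoning
  rest : ∏ (f ∘ suc) * g (suc u) ≡ ∏ (g ∘ suc) * f (suc u)
  rest = ∏-update (f ∘ suc) (g ∘ suc) u (λ x x≢u → agree (suc x) (x≢u ∘ suc-injective))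

∏-exchange : ∀ {n} (f g : Fin n → ℕ) {u v} → u ≢ v → (∀ x → x ≢ u → x ≢ v → f x ≡ g x) →
             ∏ f * (g u * g v) ≡ ∏ g * (f u * f v)
∏-exchange f g {u} {v} u≢v agree = begin
    ∏ f * (g u * g v)   ≡⟨ *-assoc (∏ f) _ _ ⟨
    ∏ f * g u * g v     ≡⟨ cong (λ z → ∏ f * z * g v) hu≡gu ⟨
    ∏ f * h u * g v     ≡⟨ cong (_* g v) (∏-update f h u f≈h) ⟩
    ∏ h * f u * g v     ≡⟨ reorder (∏ h) (f u) (g v) ⟩
    ∏ h * g v * f u     ≡⟨ cong (_* f u) (∏-update h g v h≈g) ⟩
    ∏ g * h v * f u     ≡⟨ cong (λ z → ∏ g * z * f u) hv≡fv ⟩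
    ∏ g * f v * f u     ≡⟨ reorder (∏ g) (f v) (f u) ⟩
    ∏ g * f u * f v     ≡⟨ *-assoc (∏ g) _ _ ⟩
    ∏ g * (f u * f v)   ∎
  where
  open ≡-Reasoning
  h : Fin _ → ℕ
  h = updateAt f u (const (g u))
  hu≡gu : h u ≡ g u
  hu≡gu = updateAt-updates u f
  f≈h : ∀ x → x ≢ u → f x ≡ h x
  f≈h x x≢u = ≡-sym (updateAt-minimal x u f x≢u)
  hv≡fv : h v ≡ f v
  hv≡fv = updateAt-minimal v u f (u≢v ∘ ≡-sym)
  h≈g : ∀ x → x ≢ v → h x ≡ g x
  h≈g x x≢v with x ≟ u
  ... | yes refl = hu≡gu
  ... | no x≢u   = trans (updateAt-minimal x u f x≢u) (agree x x≢u x≢v)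
  reorder : ∀ p a b → p * a * b ≡ p * b * a
  reorder = solve-∀

∏-increase : ∀ {n} (f g : Fin n → ℕ) {u v} → u ≢ v → (∀ x → x ≢ u → x ≢ v → f x ≡ g x) →
             (∀ x → 0 < f x) → f u * f v < g u * g v → ∏ f < ∏ g
∏-increase f g {u} {v} u≢v agree pos grows = *-cancelʳ-< (f u * f v) (∏ f) (∏ g) (begin-strict
    ∏ f * (f u * f v) <⟨ *-monoʳ-< (∏ f) {{>-nonZero (∏-pos f pos)}} grows ⟩
    ∏ f * (g u * g v) ≡⟨ ∏-exchange f g u≢v agree ⟩
    ∏ g * (f u * f v) ∎)
  where open ≤-Reasoning

-- Comparison of fractions is transitive: α/β < n/m and n/m < δ/γ give
-- α/β < δ/γ, all stated cross-multiplied in ℕ.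
cross-<-trans : ∀ {α β m n γ δ} → α * m < n * β → n * γ < δ * m → α * γ < δ * β
cross-<-trans {α} {β} {m} {n} {γ} {δ} r₁ r₂ = *-cancelˡ-< (m * n) _ _ (begin-strict
    m * n * (α * γ)     ≡⟨ shuffle m n α γ ⟩
    α * m * (n * γ)     <⟨ *-mono-< r₁ r₂ ⟩
    n * β * (δ * m)     ≡⟨ shuffle′ m n β δ ⟩
    m * n * (δ * β)     ∎)
  where
  open ≤-Reasoning
  shuffle : ∀ m n α γ → m * n * (α * γ) ≡ α * m * (n * γ)
  shuffle = solve-∀
  shuffle′ : ∀ m n β δ → n * β * (δ * m) ≡ m * n * (δ * β)
  shuffle′ = solve-∀

StrictlyLogConvex : (ℕ → ℕ) → Set
StrictlyLogConvex f = ∀ k → f (suc k) * f (suc k) < f (suc (suc k)) * f k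

module LogConvex (f : ℕ → ℕ) (convex : StrictlyLogConvex f) where

  ratio-trans : ∀ {a b c d e g} → f a * f d < f c * f b → f c * f g < f e * f d → f a * f g < f e * f b
  ratio-trans {a} {b} {c} {d} {e} {g} = cross-<-trans {f a} {f b} {f d} {f c} {f g} {f e}

  ratio-increasing : ∀ {x y} → x < y → f (suc x) * f y < f (suc y) * f x
  ratio-increasing {x} {suc y} x<1+y with m≤n⇒m<n∨m≡n (s≤s⁻¹ x<1+y)
  ... | inj₂ refl = convex x
  ... | inj₁ x<y  = ratio-trans (ratio-increasing x<y) (convex y)

  -- Moving t ≥ 1 units from the smaller argument b to the larger a strictly
  -- increases f(a)·f(b): the ratio f(b+t)/f(b) is below f(a+t)/f(a).
  transfer : ∀ {a b} → b < a → ∀ t → 0 < t → f a * f (t + b) < f (t + a) * f b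
  transfer b<a zero ()
  transfer {a} {b} b<a (suc zero) _ =
    subst (_< f (suc a) * f b) (*-comm (f (suc b)) (f a)) (ratio-increasing b<a)
  transfer {a} {b} b<a (suc (suc t)) _ =
    ratio-trans (transfer b<a (suc t) z<s)
      (subst (_< f (suc (suc t) + a) * f (suc t + b)) (*-comm (f (suc (suc t) + b)) (f (suc t + a)))
        (ratio-increasing (+-monoʳ-< (suc t) b<a)))

selfPow : ℕ → ℕ
selfPow x = x ^ x

-- x^x ≥ 1, including 0^0 = 1.
selfPow-pos : ∀ x → 0 < selfPow x
selfPow-pos zero    = z<s
selfPow-pos (suc x) = m^n>0 (suc x) (suc x)

^-distribʳ-* : ∀ a b k → (a * b) ^ k ≡ a ^ k * b ^ k
^-distribʳ-* a b zero    = refl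
^-distribʳ-* a b (suc k) = begin
    a * b * (a * b) ^ k     ≡⟨ cong (a * b *_) (^-distribʳ-* a b k) ⟩
    a * b * (a ^ k * b ^ k) ≡⟨ interchange a b (a ^ k) (b ^ k) ⟩
    a * a ^ k * (b * b ^ k) ∎
  where
  open ≡-Reasoning
  interchange : ∀ a b x y → a * b * (x * y) ≡ a * x * (b * y)
  interchange = solve-∀

bernoulli : ∀ M k → suc M ^ suc k ≤ suc M * M ^ k + k * suc M ^ k
bernoulli M zero    = ≤-reflexive (≡-sym (+-identityʳ _))
bernoulli M (suc k) = begin
    suc M * suc M ^ suc k                     ≤⟨ *-monoʳ-≤ (suc M) (bernoulli M k) ⟩
    suc M * (suc M * Y + k * X)                     ≡⟨ expand M X Y k ⟩
    suc M * (M * Y) + (suc M * Y + k * (suc M * X)) ≤⟨ +-monoʳ-≤ (suc M * (M * Y)) (+-monoˡ-≤ (k * (suc M * X)) M+1·Y≤M+1·X) ⟩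
    suc M * (M * Y) + (suc M * X + k * (suc M * X)) ≡⟨⟩
    suc M * M ^ suc k + suc k * suc M ^ suc k       ∎
  where
  open ≤-Reasoning
  X = suc M ^ k
  Y = M ^ k
  M+1·Y≤M+1·X : suc M * Y ≤ suc M * X
  M+1·Y≤M+1·X = *-monoʳ-≤ (suc M) (^-monoˡ-≤ k (n≤1+n M))
  expand : ∀ M X Y k → suc M * (suc M * Y + k * X) ≡ suc M * (M * Y) + (suc M * Y + k * (suc M * X))
  expand = solve-∀

-- With M = (k+2)k, so that M+1 = (k+1)², the
-- claim reads (M+1)^(k+1) < (k+2)²·M^k; Bernoulli gives (k²+k+1)(M+1)^k ≤ (M+1)M^k,
-- and (k+1)⁴ < (k+2)²(k²+k+1) closes the gap.
selfPow-logConvex : StrictlyLogConvex selfPow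
selfPow-logConvex k = *-cancelˡ-< (suc M) _ _ (begin-strict
    suc M * (selfPow (suc k) * selfPow (suc k)) ≡⟨ cong (suc M *_) lhs ⟩
    suc M * (suc M * X)                         ≡⟨ *-assoc (suc M) (suc M) X ⟨
    suc M * suc M * X                           <⟨ *-monoˡ-< X {{m^n≢0 (suc M) k}} poly ⟩
    (k + 2) * (k + 2) * q * X                   ≡⟨ *-assoc ((k + 2) * (k + 2)) q X ⟩
    (k + 2) * (k + 2) * (q * X)                 ≤⟨ *-monoʳ-≤ ((k + 2) * (k + 2)) qX≤ ⟩
    (k + 2) * (k + 2) * (suc M * Y)             ≡⟨ swap ((k + 2) * (k + 2)) (suc M) Y ⟩
    suc M * ((k + 2) * (k + 2) * Y)             ≡⟨ cong (suc M *_) rhs ⟨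
    suc M * (selfPow (suc (suc k)) * selfPow k) ∎)
  where
  open ≤-Reasoning
  M = suc (suc k) * k
  X = suc M ^ k
  Y = M ^ k
  q = k * k + k + 1
  square : suc M ≡ suc k * suc k
  square = expand k
    where
    expand : ∀ k → suc (suc (suc k) * k) ≡ suc k * suc k
    expand = solve-∀
  lhs : selfPow (suc k) * selfPow (suc k) ≡ suc M * X
  lhs = begin-equality
    suc k ^ suc k * suc k ^ suc k ≡⟨ ^-distribʳ-* (suc k) (suc k) (suc k) ⟨
    (suc k * suc k) ^ suc k       ≡⟨ cong (_^ suc k) square ⟨
    suc M ^ suc k                 ∎
  rhs : selfPow (suc (suc k)) * selfPow k ≡ (k + 2) * (k + 2) * Y
  rhs = begin-equality
    suc (suc k) * (suc (suc k) * suc (suc k) ^ k) * k ^ k ≡⟨ regroup (suc (suc k) ^ k) (k ^ k) k ⟩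
    (k + 2) * (k + 2) * (suc (suc k) ^ k * k ^ k)         ≡⟨ cong ((k + 2) * (k + 2) *_) (^-distribʳ-* (suc (suc k)) k k) ⟨
    (k + 2) * (k + 2) * Y                                 ∎
    where
    regroup : ∀ a b k → suc (suc k) * (suc (suc k) * a) * b ≡ (k + 2) * (k + 2) * (a * b)
    regroup = solve-∀
  swap : ∀ a m y → a * (m * y) ≡ m * (a * y)
  swap = solve-∀
  poly : suc M * suc M < (k + 2) * (k + 2) * q
  poly = subst₂ _<_ (≡-sym (cong₂ _*_ square square)) (≡-sym (expand k)) (m<m+n _ z<s)
    where
    expand : ∀ k → (k + 2) * (k + 2) * (k * k + k + 1)
                 ≡ suc k * suc k * (suc k * suc k) + suc (k * k * k + 3 * (k * k) + 4 * k + 2)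
    expand = solve-∀
  qX≤ : q * X ≤ suc M * Y
  qX≤ = +-cancelʳ-≤ (k * X) _ _ (begin
    q * X + k * X     ≡⟨ split k X ⟨
    suc M * X         ≤⟨ bernoulli M k ⟩
    suc M * Y + k * X ∎)
    where
    split : ∀ k X → suc (suc (suc k) * k) * X ≡ (k * k + k + 1) * X + k * X
    split = solve-∀

<ᵇ-exactly-one : ∀ {m n} → m ≢ n → ι (m <ᵇ n) + ι (n <ᵇ m) ≡ 1
<ᵇ-exactly-one {zero}  {zero}  0≢0 = contradiction refl 0≢0
<ᵇ-exactly-one {zero}  {suc n} _   = refl
<ᵇ-exactly-one {suc m} {zero}  _   = refl
<ᵇ-exactly-one {suc m} {suc n} m≢n = <ᵇ-exactly-one (m≢n ∘ cong suc)

if-split : ∀ b (p q : ℕ) → (if b then p * q else 1) ≡ (if b then p else 1) * (if b then q else 1)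
if-split true  p q = refl
if-split false p q = refl

-- Π₂(G) = ∏_x d(x)^d(x): orienting each edge xy with x < y, the vertex x
-- collects one factor d(x) per out-edge and one per in-edge, d(x) in total.
module DegreeProduct {n} (G : SimpleGraph n) where

  d : Fin n → ℕ
  d = deg (adj G)

  arc : Fin n → Fin n → Bool
  arc x y = adj G x y ∧ (toℕ x <ᵇ toℕ y)

  arc-orientation : ∀ x y → ι (arc x y) + ι (arc y x) ≡ ι (adj G x y)
  arc-orientation x y rewrite SimpleGraph.sym G y x with adj G x y in xy
  ... | false = refl
  ... | true  = <ᵇ-exactly-one λ x≡y → no-loop (toℕ-injective x≡y)
    where
    no-loop : x ≢ y
    no-loop refl = contradiction (trans (≡-sym xy) (irrefl G x)) λ ()

  out-degree in-degree : Fin n → ℕ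
  out-degree x = ∑ (λ y → ι (arc x y))
  in-degree  x = ∑ (λ y → ι (arc y x))

  out+in : ∀ x → out-degree x + in-degree x ≡ d x
  out+in x = begin
    out-degree x + in-degree x               ≡⟨ ∑-distrib (λ y → ι (arc x y)) (λ y → ι (arc y x)) ⟨
    ∑ (λ y → ι (arc x y) + ι (arc y x))     ≡⟨ ∑-cong (arc-orientation x) ⟩
    ∑ (λ y → ι (adj G x y))                  ≡⟨ deg-∑ (adj G) x ⟨
    d x                                      ∎
    where open ≡-Reasoning

  prod2-degrees : prod2 (adj G) ≡ ∏ (λ x → d x ^ d x)
  prod2-degrees = begin
      prod2 (adj G)
    ≡⟨ trans (product-allFin (λ x → product (map (weight x) (allFin n)))) (∏-cong λ x → product-allFin (weight x)) ⟩
      ∏ (λ x → ∏ (weight x))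
    ≡⟨ ∏-cong (λ x → trans (∏-cong (λ y → if-split (arc x y) (d x) (d y))) (∏-distrib (tail x) (head x))) ⟩
      ∏ (λ x → ∏ (tail x) * ∏ (head x))
    ≡⟨ ∏-distrib (λ x → ∏ (tail x)) (λ x → ∏ (head x)) ⟩
      ∏ (λ x → ∏ (tail x)) * ∏ (λ x → ∏ (head x))
    ≡⟨ cong₂ _*_ (∏-cong λ x → ∏-power (arc x) (d x))
                 (trans (∏-comm head) (∏-cong λ y → ∏-power (λ x → arc x y) (d y))) ⟩
      ∏ (λ x → d x ^ out-degree x) * ∏ (λ x → d x ^ in-degree x)
    ≡⟨ ∏-distrib (λ x → d x ^ out-degree x) (λ x → d x ^ in-degree x) ⟨
      ∏ (λ x → d x ^ out-degree x * d x ^ in-degree x)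
    ≡⟨ ∏-cong (λ x → trans (≡-sym (^-distribˡ-+-* (d x) (out-degree x) (in-degree x))) (cong (d x ^_) (out+in x))) ⟩
      ∏ (λ x → d x ^ d x)
    ∎
    where
    open ≡-Reasoning
    weight : Fin n → Fin n → ℕ
    weight x y = if arc x y then d x * d y else 1
    tail head : Fin n → Fin n → ℕ
    tail x y = if arc x y then d x else 1
    head x y = if arc x y then d y else 1

==-refl : ∀ {n} (c : Fin n) → c == c ≡ true
==-refl c with c ≟ c
... | yes _   = refl
... | no c≢c  = contradiction refl c≢c

==-false : ∀ {n} {x c : Fin n} → x ≢ c → x == c ≡ false
==-false {x = x} {c} x≢c with x ≟ c
... | yes x≡c = contradiction x≡c x≢c
... | no _    = refl

touches-sound : ∀ {n} (S : Fin n → Bool) {c x y} → touches S c x y ≡ true →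
                (x ≡ c × S y ≡ true) ⊎ (y ≡ c × S x ≡ true)
touches-sound S {c} {x} {y} e with x ≟ c | S y | y ≟ c | S x
... | yes x≡c | true | _       | _    = inj₁ (x≡c , refl)
... | _       | _    | yes y≡c | true = inj₂ (y≡c , refl)

touches-sym : ∀ {n} (S : Fin n → Bool) c x y → touches S c x y ≡ touches S c y x
touches-sym S c x y = ∨-comm ((x == c) ∧ S y) ((y == c) ∧ S x)

touches-irrefl : ∀ {n} (S : Fin n → Bool) {c} → S c ≡ false → ∀ x → touches S c x x ≡ false
touches-irrefl S {c} Sc x with x ≟ c
... | yes refl = trans (∨-idem (S x)) Sc
... | no _     = refl

moved : ∀ {n} (G : SimpleGraph n) (u v : Fin n) (S : Fin n → Bool) → S u ≡ false → SimpleGraph n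
moved G u v S Su = record
  { adj    = move G u v S
  ; sym    = symmetric
  ; irrefl = λ x → subst (λ a → (a ∧ not (touches S v x x)) ∨ touches S u x x ≡ false)
                         (≡-sym (irrefl G x)) (touches-irrefl S Su x)
  }
  where
  symmetric : ∀ x y → move G u v S x y ≡ move G u v S y x
  symmetric x y rewrite SimpleGraph.sym G x y | touches-sym S v x y | touches-sym S u x y = refl

edge-count : ∀ a tv tu → (tv ≡ true → a ≡ true) → (tu ≡ true → a ≡ false) →
             ι ((a ∧ not tv) ∨ tu) + ι tv ≡ ι a + ι tu
edge-count true  true  true  _  no-u = contradiction (no-u refl) λ ()
edge-count true  true  false _  _    = refl
edge-count true  false true  _  no-u = contradiction (no-u refl) λ ()
edge-count true  false false _  _    = refl
edge-count false true  _     in-v _  = contradiction (in-v refl) λ ()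
edge-count false false true  _  _    = refl
edge-count false false false _  _    = refl

∑-point : ∀ {n} (c : Fin n) t → ∑ (λ y → ι ((y == c) ∧ t)) ≡ ι t
∑-point c true  = trans (∑-cong (λ y → cong ι (∧-identityʳ (y == c)))) (∑-indicator c)
  where
  ∑-indicator : ∀ {n} (c : Fin n) → ∑ (λ y → ι (y == c)) ≡ 1
  ∑-indicator {suc n} zero    = cong suc (∑-zero n)
  ∑-indicator {suc n} (suc c) = trans (∑-cong (λ y → cong ι (⌊⌋-map′ (cong suc) suc-injective (y ≟ c))))
                                      (∑-indicator c)
∑-point {n} c false = trans (∑-cong (λ y → cong ι (∧-zeroʳ (y == c)))) (∑-zero n)

module MovedDegrees {n} (G : SimpleGraph n) (u v : Fin n) (u≢v : u ≢ v) (S : Fin n → Bool)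
                    (S⊆N[v] : ∀ w → S w ≡ true → adj G v w ≡ true)
                    (S∩N[u] : ∀ w → S w ≡ true → adj G u w ≡ false)
                    (Su : S u ≡ false) where

  d d′ : Fin n → ℕ
  d  = deg (adj G)
  d′ = deg (move G u v S)

  s : ℕ
  s = ∑ (ι ∘ S)

  -- v ∉ S, since v has no loop.
  Sv : S v ≡ false
  Sv = ¬-not λ Sv → contradiction (trans (≡-sym (S⊆N[v] v Sv)) (irrefl G v)) λ ()

  star-degree : ∀ c → S c ≡ false → ∀ x → ∑ (λ y → ι (touches S c x y)) ≡ ι (x == c) * s + ι (S x)
  star-degree c Sc x with x ≟ c
  ... | yes refl rewrite Sc = begin
      ∑ (λ y → ι (S y ∨ ((y == x) ∧ false))) ≡⟨ ∑-cong (λ y → cong (λ b → ι (S y ∨ b)) (∧-zeroʳ (y == x))) ⟩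
      ∑ (λ y → ι (S y ∨ false))               ≡⟨ ∑-cong (λ y → cong ι (∨-identityʳ (S y))) ⟩
      s                                       ≡⟨ +-identityʳ s ⟨
      s + 0                                   ≡⟨ +-identityʳ (s + 0) ⟨
      1 * s + 0                               ∎
    where open ≡-Reasoning
  ... | no _ = ∑-point c (S x)

  touch-v⇒edge : ∀ x y → touches S v x y ≡ true → adj G x y ≡ true
  touch-v⇒edge x y t with touches-sound S {c = v} {x} {y} t
  ... | inj₁ (refl , Sy) = S⊆N[v] y Sy
  ... | inj₂ (refl , Sx) = trans (SimpleGraph.sym G x v) (S⊆N[v] x Sx)

  touch-u⇒non-edge : ∀ x y → touches S u x y ≡ true → adj G x y ≡ false
  touch-u⇒non-edge x y t with touches-sound S {c = u} {x} {y} t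
  ... | inj₁ (refl , Sy) = S∩N[u] y Sy
  ... | inj₂ (refl , Sx) = trans (SimpleGraph.sym G x u) (S∩N[u] x Sx)

  -- d′(x) + [x = v]·s = d(x) + [x = u]·s: add the star degrees at v and at u
  -- to both sides and count edge by edge with edge-count.
  degree-balance : ∀ x → d′ x + ι (x == v) * s ≡ d x + ι (x == u) * s
  degree-balance x = +-cancelʳ-≡ (ι (S x)) _ _ (begin
      d′ x + ι (x == v) * s + ι (S x)                           ≡⟨ +-assoc (d′ x) _ _ ⟩
      d′ x + (ι (x == v) * s + ι (S x))                         ≡⟨ cong₂ _+_ (deg-∑ (move G u v S) x) (≡-sym (star-degree v Sv x)) ⟩
      ∑ (λ y → ι (move G u v S x y)) + ∑ (λ y → ι (tv y))       ≡⟨ ∑-distrib (λ y → ι (move G u v S x y)) (ι ∘ tv) ⟨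
      ∑ (λ y → ι (move G u v S x y) + ι (tv y))                 ≡⟨ ∑-cong (λ y → edge-count _ (tv y) (tu y) (touch-v⇒edge x y) (touch-u⇒non-edge x y)) ⟩
      ∑ (λ y → ι (adj G x y) + ι (tu y))                        ≡⟨ ∑-distrib (λ y → ι (adj G x y)) (ι ∘ tu) ⟩
      ∑ (λ y → ι (adj G x y)) + ∑ (λ y → ι (tu y))              ≡⟨ cong₂ _+_ (≡-sym (deg-∑ (adj G) x)) (star-degree u Su x) ⟩
      d x + (ι (x == u) * s + ι (S x))                          ≡⟨ +-assoc (d x) _ _ ⟨
      d x + ι (x == u) * s + ι (S x)                            ∎)
    where
    open ≡-Reasoning
    tv tu : Fin n → Bool
    tv = touches S v x
    tu = touches S u x

  balance-at : ∀ x {p q} → x == v ≡ p → x == u ≡ q → d′ x + ι p * s ≡ d x + ι q * s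
  balance-at x x=v x=u = subst₂ (λ p q → d′ x + ι p * s ≡ d x + ι q * s) x=v x=u (degree-balance x)

  degree-u : d′ u ≡ s + d u
  degree-u = begin
    d′ u           ≡⟨ +-identityʳ (d′ u) ⟨
    d′ u + 0       ≡⟨ balance-at u (==-false u≢v) (==-refl u) ⟩
    d u + (s + 0)  ≡⟨ cong (d u +_) (+-identityʳ s) ⟩
    d u + s        ≡⟨ +-comm (d u) s ⟩
    s + d u        ∎
    where open ≡-Reasoning

  degree-v : d v ≡ s + d′ v
  degree-v = begin
    d v            ≡⟨ +-identityʳ (d v) ⟨
    d v + 0        ≡⟨ balance-at v (==-refl v) (==-false (u≢v ∘ ≡-sym)) ⟨
    d′ v + (s + 0) ≡⟨ cong (d′ v +_) (+-identityʳ s) ⟩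
    d′ v + s       ≡⟨ +-comm (d′ v) s ⟩
    s + d′ v       ∎
    where open ≡-Reasoning

  degree-other : ∀ x → x ≢ u → x ≢ v → d x ≡ d′ x
  degree-other x x≢u x≢v = +-cancelʳ-≡ 0 (d x) (d′ x) (≡-sym (balance-at x (==-false x≢v) (==-false x≢u)))

lemma3p4 : ∀ {n : ℕ} (G : SimpleGraph n) → Connected G →
    (u v : Fin n) → u ≢ v → adj G u v ≡ false → deg (adj G) v ≤ deg (adj G) u →
    (S : Fin n → Bool) →
    (∀ w → S w ≡ true → adj G v w ≡ true) →
    (∀ w → S w ≡ true → adj G u w ≡ false) →
    ∃[ w ] S w ≡ true →
    prod2 (adj G) < prod2 (move G u v S)
lemma3p4 G _ u v u≢v u≁v dv≤du S S⊆N[v] S∩N[u] (w , Sw) = begin-strict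
    prod2 (adj G)             ≡⟨ DegreeProduct.prod2-degrees G ⟩
    ∏ (λ x → selfPow (d x))   <⟨ ∏-increase (selfPow ∘ d) (selfPow ∘ d′) u≢v (λ x x≢u x≢v → cong selfPow (degree-other x x≢u x≢v))
                                            (selfPow-pos ∘ d) grows ⟩
    ∏ (λ x → selfPow (d′ x))  ≡⟨ DegreeProduct.prod2-degrees (moved G u v S Su) ⟨
    prod2 (move G u v S)      ∎
  where
  open ≤-Reasoning
  -- u ∉ S, as every vertex of S is adjacent to v but u is not.
  Su : S u ≡ false
  Su = ¬-not λ Su → contradiction (trans (≡-sym (S⊆N[v] u Su)) (trans (SimpleGraph.sym G v u) u≁v)) λ ()
  open MovedDegrees G u v u≢v S S⊆N[v] S∩N[u] Su
  open LogConvex selfPow selfPow-logConvex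
  s>0 : 0 < s
  s>0 = ∑-pos (ι ∘ S) w (subst (λ b → 0 < ι b) (≡-sym Sw) z<s)
  -- After the move d′(v) < d(u), and s ≥ 1 units pass from d(v) to d(u).
  d′v<du : d′ v < d u
  d′v<du = <-≤-trans (m<n+m (d′ v) s>0) (subst (_≤ d u) degree-v dv≤du)
  grows : selfPow (d u) * selfPow (d v) < selfPow (d′ u) * selfPow (d′ v)
  grows = subst₂ (λ p q → selfPow (d u) * selfPow p < selfPow q * selfPow (d′ v))
                 (≡-sym degree-v) (≡-sym degree-u) (transfer d′v<du s s>0)
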